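{- Let $n\ge1$ and let $\lambda\in P(n)$ be a partition at which $N(0,3;\lambda)$ attains its maximum over $P(n)$. For $i\ge1$ let $m_i$ be the number of parts of $\lambda$ equal to $i$. Then $m_i=0$ for $i\in\{2,5,8,11,12,14,15\}$ and for all $i\ge17$; $m_i\le1$ for $i\in\{3,6,9,10,16\}$; $m_i\le3$ for $i\in\{1,13\}$; and $m_4\le4$.
   Context: $P(n)$ is the set of partitions of $n$. $N(0,3;m)$ is the number of partitions of $m$ whose rank (largest part minus number of parts) is divisible by $3$, and for $\lambda=(\lambda_1,\dots,\lambda_k)$, $N(0,3;\lambda):=\prod_{j=1}^kN(0,3;\lambda_j)$. -}

module Defs where

open import Data.Nat using (ℕ; zero; suc; _+_; _≤_; _≥_; _≤?_; _∸_; _≟_)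
open import Data.Nat.Divisibility using (_∣?_)
open import Data.Integer using (ℤ; _⊖_; ∣_∣; +_)
import Data.Integer.Divisibility as ℤD
open import Data.List using (List; []; _∷_; length; map; filter; concatMap; upTo)
open import Data.Nat.ListAction using (sum; product)
open import Data.List.Relation.Unary.All using (All)
open import Data.List.Relation.Unary.Linked using (Linked)
open import Relation.Binary.PropositionalEquality using (_≡_)
open import Relation.Nullary using (Dec; yes; no)
open import Data.Product using (_×_)

IsPartition : ℕ → List ℕ → Set
IsPartition n λ′ = All (1 ≤_) λ′ × Linked _≥_ λ′ × sum λ′ ≡ n

-- Explicit enumeration: partitions of m with all parts ≤ k (non-increasing lists).
-- Fuel f ≥ m guarantees termination.
partsBounded : ℕ → ℕ → ℕ → List (List ℕ)
partsBounded zero    zero    k = [] ∷ []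
partsBounded zero    (suc m) k = []
partsBounded (suc f) zero    k = [] ∷ []
partsBounded (suc f) (suc m) k =
  concatMap (λ p → go p) (map suc (upTo k))
  where
  go : ℕ → List (List ℕ)
  go p with p ≤? suc m
  ... | yes _ = map (p ∷_) (partsBounded f (suc m ∸ p) p)
  ... | no  _ = []

partitions : ℕ → List (List ℕ)
partitions m = partsBounded m m m

largest : List ℕ → ℕ
largest []      = 0
largest (x ∷ _) = x

rank : List ℕ → ℤ
rank λ′ = largest λ′ ⊖ length λ′

-- 3 divides the rank (ℤ divisibility; unfolds definitionally to ℕ-divisibility of |rank|)
rankDiv3? : (λ′ : List ℕ) → Dec (+ 3 ℤD.∣ rank λ′)
rankDiv3? λ′ = 3 ∣? ∣ rank λ′ ∣

N03 : ℕ → ℕ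
N03 m = length (filter rankDiv3? (partitions m))

N03λ : List ℕ → ℕ
N03λ λ′ = product (map N03 λ′)

mult : ℕ → List ℕ → ℕ
mult i λ′ = length (filter (_≟_ i) λ′)

-- If λ has k parts equal to i
-- and some partition T of k·i has N(0,3;T) > N(0,3;i)^k, replacing those parts by
-- T gives a partition of n of larger weight; so it suffices to exhibit such a T
-- for every listed multiplicity bound. The parts 4, 7, 10, 13 have weights
-- 3, 7, 16, 37, i.e. about 1.32 per unit of size, while N(0,3;i) ≤ p(i) grows
-- subexponentially: for 17 ≤ i ≤ 33 the witnesses are checked against N(0,3;i)
-- itself, for 34 ≤ i ≤ 56 against p(i) (certified by a table of partition
-- numbers), and for larger i against p(i) ≤ 218·(6/5)^i, a discretised form of
-- the generating-function bound p(m) x^m ≤ ∏_j (1 − x^j)^{−1} at x = 5/6.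
module Submission where

open import Defs
open import Data.Nat
  using (ℕ; zero; suc; _+_; _*_; _∸_; _^_; _⊓_; _≤_; _<_; _≥_; z≤n; s≤s; s≤s⁻¹; >-nonZero; _≡ᵇ_; _≤?_; _<?_; _≟_; _%_; _/_; NonZero)
open import Data.Nat.Properties
open import Data.Nat.DivMod using (m≡m%n+[m/n]*n; m%n<n)
open import Data.Nat.ListAction using (sum; product)
open import Data.Nat.ListAction.Properties using (sum-++; product-++; sum-↭; product-↭)
open import Data.Nat.Tactic.RingSolver using (solve-∀)
open import Data.List using (List; []; _∷_; _++_; [_]; map; replicate; upTo; concatMap; length; reverse)
open import Data.List.Properties using (map-++; upTo-∷ʳ; length-++; length-map; length-filter; map-cong)
open import Data.List.Relation.Unary.All using (All; []; _∷_; all?)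
open import Data.List.Relation.Unary.All.Properties using (++⁺; ++⁻ʳ; replicate⁺)
open import Data.List.Relation.Binary.Permutation.Propositional using (_↭_; ↭-refl; ↭-sym; ↭-trans; prep)
open import Data.List.Relation.Binary.Permutation.Propositional.Properties using (All-resp-↭; map⁺; shift)
import Data.List.Sort as Sort
import Relation.Binary.Properties.DecTotalOrder as DecTotalOrderProperties
open import Data.Product using (Σ-syntax; ∃-syntax; _×_; _,_; proj₁; proj₂)
open import Data.Bool using (true; false; T)
open import Relation.Nullary using (Dec; yes; no; contradiction)
open import Relation.Nullary.Decidable using (True; toWitness; _×-dec_)
open import Relation.Unary using (Decidable)
open import Relation.Binary.PropositionalEquality hiding ([_])

open DecTotalOrderProperties ≤-decTotalOrder using (≥-decTotalOrder)
open Sort ≥-decTotalOrder using (sort; sort-↭; sort-↗)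

lookupOr : {A : Set} → List A → ℕ → A → A
lookupOr []       k       d = d
lookupOr (x ∷ xs) zero    d = x
lookupOr (x ∷ xs) (suc k) d = lookupOr xs k d

lookupOr-beyond : {A : Set} (xs : List A) {k : ℕ} {d : A} → length xs ≤ k → lookupOr xs k d ≡ d
lookupOr-beyond []       _         = refl
lookupOr-beyond (x ∷ xs) (s≤s len≤k) = lookupOr-beyond xs len≤k

lookupOr-All : {A : Set} {P : A → Set} {xs : List A} (k : ℕ) {d : A} → All P xs → P d → P (lookupOr xs k d)
lookupOr-All k       []         Pd = Pd
lookupOr-All zero    (Px ∷ _)   _  = Px
lookupOr-All (suc k) (_ ∷ Pxs)  Pd = lookupOr-All k Pxs Pd

allUpTo⇒ : {P : ℕ → Set} (P? : Decidable P) (s n : ℕ) → True (allUpTo? (λ j → P? (s + j)) n)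
  → ∀ {i} → s ≤ i → i < s + n → P i
allUpTo⇒ {P} P? s n ok s≤i i<s+n =
  subst P (m+[n∸m]≡n s≤i) (toWitness ok (subst (_ <_) (m+n∸m≡n s n) (∸-monoˡ-< i<s+n s≤i)))

sum-replicate : ∀ k i → sum (replicate k i) ≡ k * i
sum-replicate zero    i = refl
sum-replicate (suc k) i = cong (i +_) (sum-replicate k i)

sum-map-mono : {f g : ℕ → ℕ} (xs : List ℕ) → (∀ x → f x ≤ g x) → sum (map f xs) ≤ sum (map g xs)
sum-map-mono []       f≤g = z≤n
sum-map-mono (x ∷ xs) f≤g = +-mono-≤ (f≤g x) (sum-map-mono xs f≤g)

sum-map-*ʳ : (f : ℕ → ℕ) (c : ℕ) (xs : List ℕ) → sum (map f xs) * c ≡ sum (map (λ x → f x * c) xs)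
sum-map-*ʳ f c []       = refl
sum-map-*ʳ f c (x ∷ xs) = trans (*-distribʳ-+ c (f x) _) (cong (f x * c +_) (sum-map-*ʳ f c xs))

length-concatMap : {A B : Set} (G : A → List B) (xs : List A) → length (concatMap G xs) ≡ sum (map (λ x → length (G x)) xs)
length-concatMap G []       = refl
length-concatMap G (x ∷ xs) = trans (length-++ (G x)) (cong (length (G x) +_) (length-concatMap G xs))

^-∸-split : ∀ x {a p} → p ≤ a → x ^ (a ∸ p) * x ^ p ≡ x ^ a
^-∸-split x {a} {p} p≤a = trans (sym (^-distribˡ-+-* x (a ∸ p) p)) (cong (x ^_) (m∸n+n≡m p≤a))

upTo⁺ : ℕ → List ℕ
upTo⁺ k = map suc (upTo k)

sum-upTo⁺-suc : (f : ℕ → ℕ) (k : ℕ) → sum (map f (upTo⁺ (suc k))) ≡ sum (map f (upTo⁺ k)) + f (suc k)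
sum-upTo⁺-suc f k = begin
  sum (map f (upTo⁺ (suc k)))                 ≡⟨ cong (λ xs → sum (map f (map suc xs))) (upTo-∷ʳ k) ⟨
  sum (map f (map suc (upTo k ++ [ k ])))      ≡⟨ cong (λ xs → sum (map f xs)) (map-++ suc (upTo k) [ k ]) ⟩
  sum (map f (upTo⁺ k ++ [ suc k ]))           ≡⟨ cong sum (map-++ f (upTo⁺ k) _) ⟩
  sum (map f (upTo⁺ k) ++ [ f (suc k) ])       ≡⟨ sum-++ (map f (upTo⁺ k)) _ ⟩
  sum (map f (upTo⁺ k)) + (f (suc k) + 0)      ≡⟨ cong (sum (map f (upTo⁺ k)) +_) (+-identityʳ _) ⟩
  sum (map f (upTo⁺ k)) + f (suc k)            ∎
  where open ≡-Reasoning

sum-upTo⁺-≤ : (f b : ℕ → ℕ) → (∀ k → b k + f (suc k) ≤ b (suc k)) → ∀ k → sum (map f (upTo⁺ k)) ≤ b k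
sum-upTo⁺-≤ f b step zero    = z≤n
sum-upTo⁺-≤ f b step (suc k) = begin
  sum (map f (upTo⁺ (suc k)))       ≡⟨ sum-upTo⁺-suc f k ⟩
  sum (map f (upTo⁺ k)) + f (suc k) ≤⟨ +-monoˡ-≤ (f (suc k)) (sum-upTo⁺-≤ f b step k) ⟩
  b k + f (suc k)                   ≤⟨ step k ⟩
  b (suc k)                         ∎
  where open ≤-Reasoning

-- Maximisers of a multiplicative weight

weight : (ℕ → ℕ) → List ℕ → ℕ
weight w xs = product (map w xs)

weight-++ : ∀ w xs ys → weight w (xs ++ ys) ≡ weight w xs * weight w ys
weight-++ w xs ys = trans (cong product (map-++ w xs ys)) (product-++ (map w xs) (map w ys))

weight-↭ : ∀ w {xs ys} → xs ↭ ys → weight w xs ≡ weight w ys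
weight-↭ w xs↭ys = product-↭ (map⁺ w xs↭ys)

weight-replicate : ∀ w k i → weight w (replicate k i) ≡ w i ^ k
weight-replicate w zero    i = refl
weight-replicate w (suc k) i = cong (w i *_) (weight-replicate w k i)

sort-isPartition : ∀ {xs} → All (1 ≤_) xs → IsPartition (sum xs) (sort xs)
sort-isPartition {xs} pos = All-resp-↭ (↭-sym (sort-↭ xs)) pos , sort-↗ xs , sum-↭ (sort-↭ xs)

mult-↭ : ∀ i k xs → k ≤ mult i xs → ∃[ rest ] xs ↭ replicate k i ++ rest
mult-↭ i zero    xs       _ = xs , ↭-refl
-- mult i normalises to a test on i ≡ᵇ x (not on i ≟ x), so that is what we branch on.
mult-↭ i (suc k) (x ∷ xs) k<mult with i ≡ᵇ x in i≡ᵇx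
... | true with ≡ᵇ⇒≡ i x (subst T (sym i≡ᵇx) _)
...   | refl = let rest , xs↭ = mult-↭ i k xs (s≤s⁻¹ k<mult) in rest , prep i xs↭
mult-↭ i (suc k) (x ∷ xs) k<mult | false =
  let rest , xs↭ = mult-↭ i (suc k) xs k<mult in
  x ∷ rest , ↭-trans (prep x xs↭) (↭-sym (shift x (replicate (suc k) i) rest))

Improvable : (ℕ → ℕ) → ℕ → Set
Improvable w i = Σ[ parts ∈ List ℕ ] All (1 ≤_) parts × sum parts ≡ i × w i < weight w parts

module Maximiser (w : ℕ → ℕ) (w1>0 : 0 < w 1) {n : ℕ} {λ′ : List ℕ} (λ′∈P : IsPartition n λ′)
                 (maximal : ∀ μ → IsPartition n μ → weight w μ ≤ weight w λ′) where

  weight>0 : 0 < weight w λ′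
  weight>0 = begin-strict
    0                               <⟨ m^n>0 (w 1) {{>-nonZero w1>0}} n ⟩
    w 1 ^ n                         ≡⟨ weight-replicate w n 1 ⟨
    weight w (replicate n 1)        ≡⟨ weight-↭ w (sort-↭ (replicate n 1)) ⟨
    weight w (sort (replicate n 1)) ≤⟨ maximal _ ones∈P ⟩
    weight w λ′                     ∎
    where
    open ≤-Reasoning
    ones∈P : IsPartition n (sort (replicate n 1))
    ones∈P = subst (λ m → IsPartition m (sort (replicate n 1))) (trans (sum-replicate n 1) (*-identityʳ n))
                   (sort-isPartition (replicate⁺ n (s≤s z≤n)))

  exchange : ∀ {S R S′} → λ′ ↭ S ++ R → All (1 ≤_) S′ → sum S′ ≡ sum S → weight w S′ ≤ weight w S
  exchange {S} {R} {S′} λ′↭ posS′ sumS′ = *-cancelʳ-≤ _ _ (weight w R) {{R≢0}} (begin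
    weight w S′ * weight w R     ≡⟨ weight-++ w S′ R ⟨
    weight w (S′ ++ R)           ≡⟨ weight-↭ w (sort-↭ (S′ ++ R)) ⟨
    weight w (sort (S′ ++ R))    ≤⟨ maximal _ μ∈P ⟩
    weight w λ′                 ≡⟨ λ′≡S++R ⟩
    weight w S * weight w R     ∎)
    where
    open ≤-Reasoning
    λ′≡S++R : weight w λ′ ≡ weight w S * weight w R
    λ′≡S++R = trans (weight-↭ w λ′↭) (weight-++ w S R)
    R≢0 : NonZero (weight w R)
    R≢0 = m*n≢0⇒n≢0 (weight w S) {{subst NonZero λ′≡S++R (>-nonZero weight>0)}}
    sum≡n : sum (S′ ++ R) ≡ n
    sum≡n = begin-equality
      sum (S′ ++ R)     ≡⟨ sum-++ S′ R ⟩
      sum S′ + sum R    ≡⟨ cong (_+ sum R) sumS′ ⟩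
      sum S + sum R    ≡⟨ sum-++ S R ⟨
      sum (S ++ R)     ≡⟨ sum-↭ λ′↭ ⟨
      sum λ′           ≡⟨ proj₂ (proj₂ λ′∈P) ⟩
      n                ∎
    μ∈P : IsPartition n (sort (S′ ++ R))
    μ∈P = subst (λ m → IsPartition m (sort (S′ ++ R))) sum≡n
                (sort-isPartition (++⁺ posS′ (++⁻ʳ S (All-resp-↭ λ′↭ (proj₁ λ′∈P)))))

  mult-< : ∀ {i k S′} → All (1 ≤_) S′ → sum S′ ≡ k * i → w i ^ k < weight w S′ → mult i λ′ < k
  mult-< {i} {k} {S′} posS′ sumS′ heavier = ≰⇒> λ k≤mult →
    let _ , λ′↭ = mult-↭ i k λ′ k≤mult in
    <⇒≱ heavier (subst (weight w S′ ≤_) (weight-replicate w k i)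
                  (exchange {S = replicate k i} λ′↭ posS′ (trans sumS′ (sym (sum-replicate k i)))))

  improvable⇒mult≡0 : ∀ {i} → Improvable w i → mult i λ′ ≡ 0
  improvable⇒mult≡0 {i} (parts , pos , sum≡ , heavier) =
    n<1⇒n≡0 (mult-< pos (trans sum≡ (sym (*-identityˡ i)))
                     (subst (_< weight w parts) (sym (*-identityʳ (w i))) heavier))

-- Counting partitions with bounded parts

#parts : ℕ → ℕ → ℕ → ℕ
#parts fuel m k = length (partsBounded fuel m k)

-- Given counts c m′ k′ of partitions of m′ with parts ≤ k′, the number of
-- partitions of m + 1 with largest part p.
withLargest : (ℕ → ℕ → ℕ) → ℕ → ℕ → ℕ
withLargest c m p with p ≤? suc m
... | yes _ = c (suc m ∸ p) p
... | no  _ = 0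

withLargest-beyond : ∀ c {m k} → m < k → withLargest c m (suc k) ≡ 0
withLargest-beyond c {m} {k} m<k with suc k ≤? suc m
... | yes k≤m = contradiction (s≤s⁻¹ k≤m) (<⇒≱ m<k)
... | no  _   = refl

#parts-suc : ∀ fuel m k → #parts (suc fuel) (suc m) k ≡ sum (map (withLargest (#parts fuel) m) (upTo⁺ k))
#parts-suc fuel m k = trans (length-concatMap step (upTo⁺ k)) (cong sum (map-cong length-step (upTo⁺ k)))
  where
  -- the body of partsBounded's inner loop, obtained by unfolding it once
  unfolded : ∃[ step ] partsBounded (suc fuel) (suc m) k ≡ concatMap step (upTo⁺ k)
  unfolded = _ , refl
  step : ℕ → List (List ℕ)
  step = proj₁ unfolded
  length-step : ∀ p → length (step p) ≡ withLargest (#parts fuel) m p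
  length-step p with p ≤? suc m
  ... | yes _ = length-map (p ∷_) (partsBounded fuel (suc m ∸ p) p)
  ... | no  _ = refl

-- A supersolution β of the partition recurrence, weighted by u, dominates the counts.
#parts-bound : ∀ (u N : ℕ) (β : ℕ → ℕ → ℕ) → (∀ k → 1 ≤ β 0 k)
  → (∀ m k → m < N → sum (map (λ p → withLargest β m p * u ^ p) (upTo⁺ k)) ≤ β (suc m) k)
  → ∀ fuel m k → m ≤ N → #parts fuel m k * u ^ m ≤ β m k
#parts-bound u N β base super zero       zero    k _   = base k
#parts-bound u N β base super (suc fuel) zero    k _   = base k
#parts-bound u N β base super zero       (suc m) k _   = z≤n
#parts-bound u N β base super (suc fuel) (suc m) k m<N = begin
  #parts (suc fuel) (suc m) k * u ^ suc m
    ≡⟨ cong (_* u ^ suc m) (#parts-suc fuel m k) ⟩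
  sum (map (withLargest (#parts fuel) m) (upTo⁺ k)) * u ^ suc m
    ≡⟨ sum-map-*ʳ (withLargest (#parts fuel) m) (u ^ suc m) (upTo⁺ k) ⟩
  sum (map (λ p → withLargest (#parts fuel) m p * u ^ suc m) (upTo⁺ k))
    ≤⟨ sum-map-mono (upTo⁺ k) term-bound ⟩
  sum (map (λ p → withLargest β m p * u ^ p) (upTo⁺ k))
    ≤⟨ super m k m<N ⟩
  β (suc m) k ∎
  where
  open ≤-Reasoning
  term-bound : ∀ p → withLargest (#parts fuel) m p * u ^ suc m ≤ withLargest β m p * u ^ p
  term-bound p with p ≤? suc m
  ... | no  _   = z≤n
  ... | yes p≤ = begin
    #parts fuel (suc m ∸ p) p * u ^ suc m                   ≡⟨ cong (#parts fuel (suc m ∸ p) p *_) (^-∸-split u p≤) ⟨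
    #parts fuel (suc m ∸ p) p * (u ^ (suc m ∸ p) * u ^ p)   ≡⟨ *-assoc (#parts fuel (suc m ∸ p) p) (u ^ (suc m ∸ p)) (u ^ p) ⟨
    #parts fuel (suc m ∸ p) p * u ^ (suc m ∸ p) * u ^ p     ≤⟨ *-monoˡ-≤ (u ^ p) IH ⟩
    β (suc m ∸ p) p * u ^ p                                 ∎
    where
    IH = #parts-bound u N β base super fuel (suc m ∸ p) p (≤-trans (m∸n≤m (suc m) p) m<N)

-- Partition numbers up to 56, certified by a table

Table : Set
Table = List (List ℕ)

tableEntry : Table → ℕ → ℕ → ℕ
tableEntry t m k = lookupOr (lookupOr t m []) (m ⊓ k) 0

-- Row m holds q(m,0), …, q(m,m), where q(m,k) = q(m,k−1) + q(m−k, min(k,m−k))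
-- counts partitions of m into parts ≤ k; rows are built newest first. The table
-- is only used as a certificate: its recurrence is checked below, never proved.
partitionTable : ℕ → Table
partitionTable n = reverse (rowsDownFrom n)
  where
  columns : (m : ℕ) → Table → (remaining k acc : ℕ) → List ℕ
  columns m older zero          k acc = []
  columns m older (suc remaining) k acc =
    push (acc + lookupOr (lookupOr older (k ∸ 1) []) (k ⊓ (m ∸ k)) 0)
    where
    push : ℕ → List ℕ
    push next = next ∷ columns m older remaining (suc k) next
  withRow : ℕ → Table → Table
  withRow m older = (0 ∷ columns m older m 1 0) ∷ older
  rowsDownFrom : ℕ → Table
  rowsDownFrom zero    = (1 ∷ []) ∷ []
  rowsDownFrom (suc m) = withRow (suc m) (rowsDownFrom m)

TableStep : Table → ℕ → ℕ → Set
TableStep t m k = tableEntry t (suc m) k + withLargest (tableEntry t) m (suc k) ≤ tableEntry t (suc m) (suc k)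

TableSteps : Table → ℕ → Set
TableSteps t N = ∀ {m} → m < N → ∀ {k} → k < suc m → TableStep t m k

tableStep? : ∀ t m k → Dec (TableStep t m k)
tableStep? t m k = _ ≤? _

tableSteps? : ∀ t N → Dec (TableSteps t N)
tableSteps? t N = allUpTo? (λ m → allUpTo? (tableStep? t m) (suc m)) N

table-supersolution : ∀ {t N} → TableSteps t N → ∀ m k → m < N
  → sum (map (λ p → withLargest (tableEntry t) m p * 1 ^ p) (upTo⁺ k)) ≤ tableEntry t (suc m) k
table-supersolution {t} steps m k m<N = sum-upTo⁺-≤ _ (tableEntry t (suc m)) step k
  where
  row = lookupOr t (suc m) []
  step : ∀ k → tableEntry t (suc m) k + withLargest (tableEntry t) m (suc k) * 1 ^ suc k ≤ tableEntry t (suc m) (suc k)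
  step k rewrite ^-zeroˡ (suc k) | *-identityʳ (withLargest (tableEntry t) m (suc k)) with k ≤? m
  ... | yes k≤m = steps m<N (s≤s k≤m)
  ... | no  k≰m = ≤-reflexive (begin-equality
    lookupOr row (suc m ⊓ k) 0 + withLargest (tableEntry t) m (suc k)
      ≡⟨ cong₂ _+_ (cong (λ c → lookupOr row c 0) (m≤n⇒m⊓n≡m m<k)) (withLargest-beyond (tableEntry t) m<k) ⟩
    lookupOr row (suc m) 0 + 0
      ≡⟨ +-identityʳ _ ⟩
    lookupOr row (suc m) 0
      ≡⟨ cong (λ c → lookupOr row c 0) (m≤n⇒m⊓n≡m (s≤s (<⇒≤ m<k))) ⟨
    lookupOr row (suc m ⊓ suc k) 0 ∎)
    where
    open ≤-Reasoning
    m<k = ≰⇒> k≰m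

partitions≤tableEntry : ∀ {t N} → TableSteps t N → 1 ≤ tableEntry t 0 0 → ∀ i → i ≤ N → length (partitions i) ≤ tableEntry t i i
partitions≤tableEntry {t} {N} steps base i i≤N =
  subst (_≤ tableEntry t i i) (trans (cong (#parts i i i *_) (^-zeroˡ i)) (*-identityʳ _))
    (#parts-bound 1 N (tableEntry t) (λ _ → base) (table-supersolution {t} steps) i i i i≤N)

table : Table
table = partitionTable 56

partitions≤table : ∀ i → i ≤ 56 → length (partitions i) ≤ tableEntry table i i
partitions≤table = partitions≤tableEntry {table} {56} (toWitness {a? = tableSteps? table 56} _) (s≤s z≤n)

-- A geometric bound for all partition numbers

weightedSum : ℕ → ℕ → (ℕ → ℕ) → ℕ → ℕ
weightedSum u v g zero    = 0
weightedSum u v g (suc k) = v * weightedSum u v g k + g (suc k) * u ^ suc k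

module Geometric (u v : ℕ) .{{_ : NonZero v}} (g : ℕ → ℕ)
                 (super : ∀ k → weightedSum u v g k ≤ g k * v ^ k) where

  β : ℕ → ℕ → ℕ
  β m k = g k * v ^ m

  largest-term : ∀ m p → withLargest β m p * u ^ p * v ^ p ≤ v ^ suc m * (g p * u ^ p)
  largest-term m p with p ≤? suc m
  ... | no  _   = z≤n
  ... | yes p≤ = ≤-reflexive (begin
    g p * v ^ (suc m ∸ p) * u ^ p * v ^ p     ≡⟨ regroup (g p) (v ^ (suc m ∸ p)) (u ^ p) (v ^ p) ⟩
    v ^ (suc m ∸ p) * v ^ p * (g p * u ^ p)   ≡⟨ cong (_* (g p * u ^ p)) (^-∸-split v p≤) ⟩
    v ^ suc m * (g p * u ^ p)                 ∎)
    where
    open ≡-Reasoning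
    regroup : ∀ G A U B → G * A * U * B ≡ A * B * (G * U)
    regroup = solve-∀

  scaled-sum : ∀ m k → sum (map (λ p → withLargest β m p * u ^ p) (upTo⁺ k)) * v ^ k ≤ v ^ suc m * weightedSum u v g k
  scaled-sum m zero    = z≤n
  scaled-sum m (suc k) = begin
    S (suc k) * v ^ suc k                        ≡⟨ cong (_* v ^ suc k) (sum-upTo⁺-suc f k) ⟩
    (S k + f (suc k)) * (v * v ^ k)              ≡⟨ expand (S k) (f (suc k)) v (v ^ k) ⟩
    v * (S k * v ^ k) + f (suc k) * v ^ suc k    ≤⟨ +-mono-≤ (*-monoʳ-≤ v (scaled-sum m k)) (largest-term m (suc k)) ⟩
    v * (V * W k) + V * (g (suc k) * u ^ suc k)  ≡⟨ collect v V (W k) (g (suc k) * u ^ suc k) ⟩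
    V * W (suc k)                                ∎
    where
    open ≤-Reasoning
    f : ℕ → ℕ
    f p = withLargest β m p * u ^ p
    S : ℕ → ℕ
    S k = sum (map f (upTo⁺ k))
    V = v ^ suc m
    W = weightedSum u v g
    expand : ∀ S F v X → (S + F) * (v * X) ≡ v * (S * X) + F * (v * X)
    expand = solve-∀
    collect : ∀ v V W T → v * (V * W) + V * T ≡ V * (v * W + T)
    collect = solve-∀

  supersolution : ∀ m k → sum (map (λ p → withLargest β m p * u ^ p) (upTo⁺ k)) ≤ β (suc m) k
  supersolution m k = *-cancelʳ-≤ _ _ (v ^ k) {{m^n≢0 v k}} (begin
    sum (map (λ p → withLargest β m p * u ^ p) (upTo⁺ k)) * v ^ k  ≤⟨ scaled-sum m k ⟩
    v ^ suc m * weightedSum u v g k                                  ≤⟨ *-monoʳ-≤ (v ^ suc m) (super k) ⟩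
    v ^ suc m * (g k * v ^ k)                                        ≡⟨ rearrange (v ^ suc m) (g k) (v ^ k) ⟩
    g k * v ^ suc m * v ^ k                                          ∎)
    where
    open ≤-Reasoning
    rearrange : ∀ V G X → V * (G * X) ≡ G * V * X
    rearrange = solve-∀

  partitions-bound : (∀ k → 1 ≤ g k) → ∀ n → length (partitions n) * u ^ n ≤ g n * v ^ n
  partitions-bound g≥1 n =
    #parts-bound u n β (λ k → subst (1 ≤_) (sym (*-identityʳ (g k))) (g≥1 k)) (λ m k _ → supersolution m k) n n n ≤-refl

weightedSum-tail : ∀ u g K G → (∀ k → K < k → g k ≡ G)
  → weightedSum u (suc u) g K + G * u ^ suc K ≤ G * suc u ^ K
  → ∀ k → K ≤ k → weightedSum u (suc u) g k ≤ G * suc u ^ k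
weightedSum-tail u g K G g≡G initial k K≤k =
  subst (λ k → W k ≤ G * v ^ k) (m∸n+n≡m K≤k) (bounded (k ∸ K))
  where
  v = suc u
  W = weightedSum u v g
  -- Once g ≡ G, adding the slack G·u^(k+1) makes the recursion exactly geometric.
  invariant : ∀ j → W (j + K) + G * u ^ suc (j + K) ≡ v ^ j * (W K + G * u ^ suc K)
  invariant zero    = sym (*-identityˡ _)
  invariant (suc j) = begin
    v * W (j + K) + g (suc (j + K)) * U + G * (u * U)
      ≡⟨ cong (λ c → v * W (j + K) + c * U + G * (u * U)) (g≡G (suc (j + K)) (s≤s (m≤n+m K j))) ⟩
    v * W (j + K) + G * U + G * (u * U)
      ≡⟨ collect u (W (j + K)) G U ⟩
    v * (W (j + K) + G * U)
      ≡⟨ cong (v *_) (invariant j) ⟩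
    v * (v ^ j * (W K + G * u ^ suc K))
      ≡⟨ *-assoc v (v ^ j) _ ⟨
    v ^ suc j * (W K + G * u ^ suc K) ∎
    where
    open ≡-Reasoning
    U = u ^ suc (j + K)
    collect : ∀ u W G U → suc u * W + G * U + G * (u * U) ≡ suc u * (W + G * U)
    collect = solve-∀
  bounded : ∀ j → W (j + K) ≤ G * v ^ (j + K)
  bounded j = begin
    W (j + K)                          ≤⟨ m≤m+n _ _ ⟩
    W (j + K) + G * u ^ suc (j + K)    ≡⟨ invariant j ⟩
    v ^ j * (W K + G * u ^ suc K)      ≤⟨ *-monoʳ-≤ (v ^ j) initial ⟩
    v ^ j * (G * v ^ K)                ≡⟨ swap (v ^ j) G (v ^ K) ⟩
    G * (v ^ j * v ^ K)                ≡⟨ cong (G *_) (^-distribˡ-+-* v j K) ⟨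
    G * v ^ (j + K)                    ∎
    where
    open ≤-Reasoning
    swap : ∀ A G B → A * (G * B) ≡ G * (A * B)
    swap = solve-∀

-- Up to k = 30 these are the least values with weightedSum 5 6 g k ≤ g k · 6^k,
-- namely ⌈Σ_{p<k} g p 5^p 6^(k−p) / (6^k − 5^k)⌉; 218 then covers the whole tail.
geometricWeightList : List ℕ
geometricWeightList =
  1 ∷ 1 ∷ 3 ∷ 7 ∷ 14 ∷ 23 ∷ 35 ∷ 49 ∷ 64 ∷ 79 ∷ 94 ∷ 109 ∷ 123 ∷ 135 ∷ 147 ∷ 157 ∷
  166 ∷ 174 ∷ 181 ∷ 186 ∷ 191 ∷ 196 ∷ 199 ∷ 202 ∷ 205 ∷ 207 ∷ 209 ∷ 210 ∷ 212 ∷ 213 ∷ 214 ∷ []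

geometricWeight : ℕ → ℕ
geometricWeight k = lookupOr geometricWeightList k 218

geometricWeight-beyond : ∀ {k} → 30 < k → geometricWeight k ≡ 218
geometricWeight-beyond = lookupOr-beyond geometricWeightList

geometricWeight≥1 : ∀ k → 1 ≤ geometricWeight k
geometricWeight≥1 k = lookupOr-All k (toWitness {a? = all? (1 ≤?_) geometricWeightList} _) (s≤s z≤n)

weightedSum≤geometricWeight : ∀ k → weightedSum 5 6 geometricWeight k ≤ geometricWeight k * 6 ^ k
weightedSum≤geometricWeight k with k ≤? 30
... | yes k≤30 = toWitness {a? = allUpTo? (λ k → weightedSum 5 6 geometricWeight k ≤? geometricWeight k * 6 ^ k) 31} _ (s≤s k≤30)
... | no  k≰30 = subst (λ c → weightedSum 5 6 geometricWeight k ≤ c * 6 ^ k) (sym (geometricWeight-beyond (≰⇒> k≰30)))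
                   (weightedSum-tail 5 geometricWeight 30 218 (λ _ → geometricWeight-beyond) (toWitness {a? = _ ≤? _} _) k (<⇒≤ (≰⇒> k≰30)))

partitions-geometric : ∀ n → 30 < n → length (partitions n) * 5 ^ n ≤ 218 * 6 ^ n
partitions-geometric n 30<n = begin
  length (partitions n) * 5 ^ n  ≤⟨ Geometric.partitions-bound 5 6 geometricWeight weightedSum≤geometricWeight geometricWeight≥1 n ⟩
  geometricWeight n * 6 ^ n      ≡⟨ cong (_* 6 ^ n) {geometricWeight n} (geometricWeight-beyond 30<n) ⟩
  218 * 6 ^ n                    ∎
  where open ≤-Reasoning

-- Every part i ≥ 17 can be split profitably

N03≤partitions : ∀ i → N03 i ≤ length (partitions i)
N03≤partitions i = length-filter rankDiv3? (partitions i)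

split : ℕ → List ℕ
split i = block (i % 7) ++ replicate ((i ∸ sum (block (i % 7))) / 7) 7
  where
  block : ℕ → List ℕ
  block 1 = 4 ∷ 4 ∷ []
  block 2 = 13 ∷ 10 ∷ []
  block 3 = 10 ∷ []
  block 4 = 4 ∷ []
  block 5 = 4 ∷ 4 ∷ 4 ∷ []
  block 6 = 13 ∷ []
  block _ = []

Splits : ℕ → Set
Splits i = All (1 ≤_) (split i) × sum (split i) ≡ i

splits? : ∀ i → Dec (Splits i)
splits? i = all? (1 ≤?_) (split i) ×-dec sum (split i) ≟ i

split-improves : ∀ {b i} → N03 i ≤ b → Splits i × b < N03λ (split i) → Improvable N03 i
split-improves {i = i} N03≤b ((pos , sum≡) , b<) = split i , pos , sum≡ , ≤-<-trans N03≤b b<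

improvable-17-33 : ∀ {i} → 17 ≤ i → i < 34 → Improvable N03 i
improvable-17-33 17≤i i<34 =
  split-improves ≤-refl (allUpTo⇒ (λ i → splits? i ×-dec N03 i <? N03λ (split i)) 17 17 _ 17≤i i<34)

improvable-34-56 : ∀ {i} → 34 ≤ i → i < 57 → Improvable N03 i
improvable-34-56 {i} 34≤i i<57 =
  split-improves (≤-trans (N03≤partitions i) (partitions≤table i (s≤s⁻¹ i<57)))
    (allUpTo⇒ (λ i → splits? i ×-dec tableEntry table i i <? N03λ (split i)) 34 23 _ 34≤i i<57)

power-gap : ∀ {C x y c d} .{{_ : NonZero c}} .{{_ : NonZero y}} → x ^ d ≤ c * y ^ d
  → ∀ q {a P} → C * x ^ a < y ^ a * P → C * x ^ (q * d + a) < y ^ (q * d + a) * (c ^ q * P)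
power-gap {C} {x} {y} {c} {d} gap zero {a} {P} base = subst (λ Q → C * x ^ a < y ^ a * Q) (sym (+-identityʳ P)) base
power-gap {C} {x} {y} {c} {d} gap (suc q) {a} {P} base = begin-strict
  C * x ^ (suc q * d + a)              ≡⟨ cong (λ e → C * x ^ e) (+-assoc d (q * d) a) ⟩
  C * x ^ (d + E)                      ≡⟨ cong (C *_) (^-distribˡ-+-* x d E) ⟩
  C * (x ^ d * x ^ E)                  ≡⟨ swap C (x ^ d) (x ^ E) ⟩
  x ^ d * (C * x ^ E)                  ≤⟨ *-monoˡ-≤ (C * x ^ E) gap ⟩
  c * y ^ d * (C * x ^ E)              <⟨ *-monoʳ-< (c * y ^ d) {{m*n≢0 c (y ^ d)}} (power-gap {C} gap q base) ⟩
  c * y ^ d * (y ^ E * (c ^ q * P))    ≡⟨ regroup c (y ^ d) (y ^ E) (c ^ q) P ⟩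
  y ^ d * y ^ E * (c ^ suc q * P)      ≡⟨ cong (_* (c ^ suc q * P)) (^-distribˡ-+-* y d E) ⟨
  y ^ (d + E) * (c ^ suc q * P)        ≡⟨ cong (λ e → y ^ e * (c ^ suc q * P)) (+-assoc d (q * d) a) ⟨
  y ^ (suc q * d + a) * (c ^ suc q * P) ∎
  where
  open ≤-Reasoning
  instance
    y^d≢0 : NonZero (y ^ d)
    y^d≢0 = m^n≢0 y d
  E = q * d + a
  swap : ∀ C X Y → C * (X * Y) ≡ X * (C * Y)
  swap = solve-∀
  regroup : ∀ c Y Z Q P → c * Y * (Z * (Q * P)) ≡ Y * Z * (c * Q * P)
  regroup = solve-∀

sevens++split-improves : ∀ q {a} → 30 < a → Splits a × 218 * 6 ^ a < 5 ^ a * N03λ (split a)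
  → Improvable N03 (q * 7 + a)
sevens++split-improves q {a} 30<a ((pos , sum≡) , beats) =
  parts , ++⁺ (replicate⁺ q (s≤s z≤n)) pos , sum≡i , ≤-<-trans (N03≤partitions i) partitions<
  where
  parts = replicate q 7 ++ split a
  i = q * 7 + a
  sum≡i : sum parts ≡ i
  sum≡i = trans (sum-++ (replicate q 7) (split a)) (cong₂ _+_ (sum-replicate q 7) sum≡)
  partitions< : length (partitions i) < N03λ parts
  partitions< = *-cancelʳ-< (5 ^ i) (length (partitions i)) (N03λ parts) (begin-strict
    length (partitions i) * 5 ^ i                 ≤⟨ partitions-geometric i (≤-trans 30<a (m≤n+m a (q * 7))) ⟩
    218 * 6 ^ i                                   <⟨ power-gap {218} {6} {5} {7} {7} (toWitness {a? = 6 ^ 7 ≤? 7 * 5 ^ 7} _) q beats ⟩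
    5 ^ i * (7 ^ q * N03λ (split a))              ≡⟨ *-comm (5 ^ i) _ ⟩
    7 ^ q * N03λ (split a) * 5 ^ i                ≡⟨ cong (λ c → c * N03λ (split a) * 5 ^ i) (weight-replicate N03 q 7) ⟨
    N03λ (replicate q 7) * N03λ (split a) * 5 ^ i ≡⟨ cong (_* 5 ^ i) (weight-++ N03 (replicate q 7) (split a)) ⟨
    N03λ parts * 5 ^ i                            ∎)
    where open ≤-Reasoning

improvable-large : ∀ {i} → 57 ≤ i → Improvable N03 i
improvable-large {i} 57≤i = subst (Improvable N03) q*7+a≡i (sevens++split-improves q {a} (s≤s (m≤m+n 30 (26 + r))) base)
  where
  j = i ∸ 57
  r = j % 7
  q = j / 7
  a = 57 + r
  base : Splits a × 218 * 6 ^ a < 5 ^ a * N03λ (split a)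
  base = allUpTo⇒ (λ a → splits? a ×-dec 218 * 6 ^ a <? 5 ^ a * N03λ (split a)) 57 7 _ {a}
           (m≤m+n 57 r) (+-monoʳ-< 57 (m%n<n j 7))
  q*7+a≡i : q * 7 + a ≡ i
  q*7+a≡i = begin-equality
    q * 7 + (57 + r)   ≡⟨ reorder q r ⟩
    57 + (r + q * 7)   ≡⟨ cong (57 +_) (m≡m%n+[m/n]*n j 7) ⟨
    57 + j             ≡⟨ m+[n∸m]≡n 57≤i ⟩
    i                  ∎
    where
    open ≤-Reasoning
    reorder : ∀ q r → q * 7 + (57 + r) ≡ 57 + (r + q * 7)
    reorder = solve-∀

improvable : ∀ i → 17 ≤ i → Improvable N03 i
improvable i 17≤i with i <? 34 | i <? 57
... | yes i<34 | _        = improvable-17-33 17≤i i<34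
... | no  i≮34 | yes i<57 = improvable-34-56 (≮⇒≥ i≮34) i<57
... | no  _    | no  i≮57 = improvable-large (≮⇒≥ i≮57)

proposition3p2 : (n : ℕ) → 1 ≤ n → (λ′ : List ℕ) → IsPartition n λ′
    → ((μ : List ℕ) → IsPartition n μ → N03λ μ ≤ N03λ λ′)
    → (mult 2 λ′ ≡ 0 × mult 5 λ′ ≡ 0 × mult 8 λ′ ≡ 0 × mult 11 λ′ ≡ 0
        × mult 12 λ′ ≡ 0 × mult 14 λ′ ≡ 0 × mult 15 λ′ ≡ 0
        × ((i : ℕ) → i ≥ 17 → mult i λ′ ≡ 0))
      × (mult 3 λ′ ≤ 1 × mult 6 λ′ ≤ 1 × mult 9 λ′ ≤ 1 × mult 10 λ′ ≤ 1 × mult 16 λ′ ≤ 1)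
      × (mult 1 λ′ ≤ 3 × mult 13 λ′ ≤ 3)
      × mult 4 λ′ ≤ 4
proposition3p2 n _ λ′ λ′∈P maximal =
    ( n<1⇒n≡0 (fewerThan 1 2 (1 ∷ 1 ∷ []))
    , n<1⇒n≡0 (fewerThan 1 5 (4 ∷ 1 ∷ []))
    , n<1⇒n≡0 (fewerThan 1 8 (4 ∷ 4 ∷ []))
    , n<1⇒n≡0 (fewerThan 1 11 (7 ∷ 4 ∷ []))
    , n<1⇒n≡0 (fewerThan 1 12 (4 ∷ 4 ∷ 4 ∷ []))
    , n<1⇒n≡0 (fewerThan 1 14 (7 ∷ 7 ∷ []))
    , n<1⇒n≡0 (fewerThan 1 15 (7 ∷ 4 ∷ 4 ∷ []))
    , λ i 17≤i → improvable⇒mult≡0 (improvable i 17≤i) )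
  , ( m<1+n⇒m≤n (fewerThan 2 3 (4 ∷ 1 ∷ 1 ∷ []))
    , m<1+n⇒m≤n (fewerThan 2 6 (4 ∷ 4 ∷ 4 ∷ []))
    , m<1+n⇒m≤n (fewerThan 2 9 (7 ∷ 7 ∷ 4 ∷ []))
    , m<1+n⇒m≤n (fewerThan 2 10 (13 ∷ 7 ∷ []))
    , m<1+n⇒m≤n (fewerThan 2 16 (7 ∷ 7 ∷ 7 ∷ 7 ∷ 4 ∷ [])) )
  , ( m<1+n⇒m≤n (fewerThan 4 1 (4 ∷ []))
    , m<1+n⇒m≤n (fewerThan 4 13 (10 ∷ 7 ∷ 7 ∷ 7 ∷ 7 ∷ 7 ∷ 7 ∷ [])) )
  , m<1+n⇒m≤n (fewerThan 5 4 (13 ∷ 7 ∷ []))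
  where
  open Maximiser N03 (s≤s z≤n) λ′∈P maximal
  fewerThan : ∀ k i parts → {True (all? (1 ≤?_) parts)} → {True (sum parts ≟ k * i)}
    → {True (N03 i ^ k <? N03λ parts)} → mult i λ′ < k
  fewerThan k i parts {pos} {sum≡} {heavier} = mult-< (toWitness pos) (toWitness sum≡) (toWitness heavier)
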